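{- Let $d$ be a positive integer that is not a perfect square and let $L$ be a positive integer. Consider sequences of integers produced by the following recursion (the "second algorithm with $L$"). Let $a_1 = \lfloor\sqrt d\rfloor + 1$ if $(\lfloor\sqrt d\rfloor+1)^2 - d < d - \lfloor\sqrt d\rfloor^2$, and $a_1 = \lfloor\sqrt d\rfloor$ otherwise; let $b_1 = 1$ and $k_2 = a_1^2 - d\,b_1^2$. For $i \ge 2$, given coprime positive integers $a_{i-1}, b_{i-1}$ with $a_{i-1}^2 - d\,b_{i-1}^2 = k_i$, choose positive integers $m_{i+1}, l_{i+1}$ with $1 \le l_{i+1} \le L$ such that $k_i$ divides $a_{i-1} l_{i+1} + b_{i-1} m_{i+1}$ and such that $|m_{i+1} - \sqrt d\, l_{i+1}|$ is minimal among all pairs of positive integers $(m,l)$ with $1\le l\le L$ for which $k_i$ divides $a_{i-1} l + b_{i-1} m$; then set $$k_{i+1} = \frac{m_{i+1}^2 - d\,l_{i+1}^2}{k_i},\qquad a_i = \frac{a_{i-1} m_{i+1} + d\, b_{i-1} l_{i+1}}{|k_i|},\qquad b_i = \frac{a_{i-1} l_{i+1} + b_{i-1} m_{i+1}}{|k_i|}$$ (these are integers, $a_i, b_i$ are coprime positive integers and $a_i^2 - d\,b_i^2 = k_{i+1}$). For $i \ge 2$ let $M_i$ be the unique integer with $0 \le M_i < |k_i|$ and $M_i\, b_{i-1} \equiv -a_{i-1} \pmod{|k_i|}$ (well defined since $\gcd(b_{i-1},k_i)=1$). For $i \ge 3$ define $$r_{i-1} = \frac{m_i - M_{i-1}\,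 l_i}{|k_{i-1}|}, \qquad s_{i-1} = \frac{d\, l_i - M_{i-1}\, m_i}{|k_{i-1}|}.$$ Then for every $i \ge 3$: (a) $s_{i-1}$ is an integer; (b) $a_{i-1}\, r_{i-1} \equiv b_{i-1}\, s_{i-1} \pmod{|k_i|}$; (c) $\gcd(l_i, r_{i-1}) = 1$; (d) $M_i \equiv M_{i-1} \pmod{\gcd(l_i, k_i)}$.
   Context: Here $\lfloor x\rfloor$ is the greatest integer $\le x$. Note that $r_{i-1}$ is an integer, since the divisibility condition on $(m_i,l_i)$ is equivalent to $m_i \equiv M_{i-1} l_i \pmod{|k_{i-1}|}$. -}

module Defs where

open import Data.Nat as ℕ using (ℕ; suc)
open import Data.Integer using (ℤ; +_; _+_; _-_; _*_; -_; _≤_; _<_; _<?_; ∣_∣)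
open import Data.Integer.Divisibility using (_∣_)
open import Data.Product using (_×_; Σ)
open import Data.Sum using (_⊎_)
open import Data.Bool using (if_then_else_)
open import Relation.Nullary.Decidable using (does)
open import Relation.Binary.PropositionalEquality using (_≡_)

infix 4 _≡ₘ_[mod_]
_≡ₘ_[mod_] : ℤ → ℤ → ℤ → Set
x ≡ₘ y [mod n ] = n ∣ (x - y)

abs : ℤ → ℤ
abs x = + ∣ x ∣

-- The real number  u + v √d  is ≥ 0  (usual order on ℤ[√d], d ≥ 0):
NonNegSqrt : ℕ → ℤ → ℤ → Set
NonNegSqrt d u v =
    (+ 0 ≤ u × + 0 ≤ v)
  ⊎ (+ 0 ≤ u × v < + 0 × (+ d) * v * v ≤ u * u)
  ⊎ (u < + 0 × + 0 ≤ v × u * u ≤ (+ d) * v * v)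

-- |m - √d l| ≤ |m' - √d l'|  (real absolute values), expressed exactly as
-- (m' - √d l')² - (m - √d l)² ≥ 0, where the difference of squares equals
-- (m'² + d l'² - m² - d l²) + 2 (m l - m' l') √d.
AbsDistLe : ℕ → ℤ → ℤ → ℤ → ℤ → Set
AbsDistLe d m l m' l' =
  NonNegSqrt d (m' * m' + (+ d) * l' * l' - m * m - (+ d) * l * l)
               (+ 2 * (m * l - m' * l'))

-- a₁, given s = ⌊√d⌋.
firstA : ℕ → ℕ → ℤ
firstA d s =
  if does ((+ suc s) * (+ suc s) - + d <? + d - (+ s) * (+ s))
  then + suc s else + s

-- One step (index i ≥ 2) of the "second algorithm with L":
-- choice of (m_{i+1}, l_{i+1}) and definitions of k_{i+1}, a_i, b_i.
-- Exact divisions x = y / z (z ≠ 0) are expressed as x * z ≡ y.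
record SecondAlgStep (d L : ℕ) (a b k m l : ℕ → ℤ) (i : ℕ) : Set where
  field
    m-pos   : + 0 < m (suc i)
    l-pos   : + 1 ≤ l (suc i)
    l-le    : l (suc i) ≤ + L
    divides : k i ∣ (a (ℕ.pred i) * l (suc i) + b (ℕ.pred i) * m (suc i))
    minimal : ∀ (m' l' : ℤ) → + 0 < m' → + 1 ≤ l' → l' ≤ + L →
              k i ∣ (a (ℕ.pred i) * l' + b (ℕ.pred i) * m') →
              AbsDistLe d (m (suc i)) (l (suc i)) m' l'
    k-def   : k (suc i) * k i ≡ m (suc i) * m (suc i) - (+ d) * l (suc i) * l (suc i)
    a-def   : a i * abs (k i) ≡ a (ℕ.pred i) * m (suc i) + (+ d) * b (ℕ.pred i) * l (suc i)
    b-def   : b i * abs (k i) ≡ a (ℕ.pred i) * l (suc i) + b (ℕ.pred i) * m (suc i)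

{-# OPTIONS --safe #-}
-- Fix a step and write (a, x, k) for (a_{i-2}, b_{i-2}, k_{i-1}), (m, l) for (m_i, l_i), (M, r, s) for
-- (M_{i-1}, r_{i-1}, s_{i-1}) and (A, B, k′, M′) for (a_{i-1}, b_{i-1}, k_i, M_i); let K = |k| = σ k.
-- Since x is prime to k = a² - d x², the congruence M x ≡ -a forces M² ≡ d (mod k), so M x + a = t K and
-- M² - d = e K for integers t, e, and s = -e l - M r.  The defining relations of the algorithm then turn into
-- polynomial identities over ℤ:
--   A = x s + t m,   B = t l + x r,   σ = K t² - 2 M x t + e x²,   σ k′ = e l² + 2 M l r + K r².
-- (a) and (b) follow at once, as A r - B s = t σ k′.  For (d), g = gcd(l, k′) divides K r², hence K r
-- (g is prime to r), hence A + M B = l (2 M t - e x) + K r t; since M′ B ≡ -A (mod k′), g divides (M′ - M) B,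
-- and B is prime to k′.  (c) is where the minimality of (m, l) enters: a common factor g ≥ 2 of l and r also
-- divides m = M l + r K, so (m/g, l/g) would be an admissible pair with |m/g - √d l/g| < |m - √d l|, as
-- m - √d l ≠ 0.  The invariant gcd(B, k′) = 1 needed at the next step follows from k′ = A² - d B², since A and
-- B are coprime, being related to the coprime pair (l, r) by an invertible integral substitution.
module Submission where

open import Defs
open import Data.Nat as ℕ using (ℕ; zero; suc; _∸_; NonZero; z≤n; s≤s)
import Data.Nat.Properties as ℕ
import Data.Nat.Divisibility as ℕ
open import Data.Nat.DivMod using (_/_; m/n*n≡m)
import Data.Nat.GCD as ℕ
import Data.Nat.Coprimality as ℕ
import Data.Nat.Tactic.RingSolver as ℕ
open import Data.Integer as ℤ
  using (ℤ; +_; +[1+_]; -[1+_]; -_; _+_; _-_; _*_; _≤_; _<_; 0ℤ; 1ℤ; ∣_∣; +≤+; +<+)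
import Data.Integer.Properties as ℤ
open import Data.Integer.Divisibility.Signed
  using (_∣_; divides; quotient; ∣ᵤ⇒∣; ∣⇒∣ᵤ; ∣m∣n⇒∣m+n; ∣m∣n⇒∣m-n; ∣m+n∣n⇒∣m; ∣m⇒∣-m; ∣n⇒∣m*n; ∣m⇒∣m*n;
         ∣-trans; m∣∣m∣)
import Data.Integer.Divisibility as Unsigned
open import Data.Integer.Coprimality using (Coprime)
import Data.Integer.Coprimality as Coprime
open import Data.Integer.GCD using (gcd; gcd[i,j]∣i; gcd[i,j]∣j)
open import Data.Integer.Tactic.RingSolver using (solve)
open import Data.List using (_∷_; [])
open import Data.Product using (Σ; ∃-syntax; _×_; _,_; proj₁; proj₂; uncurry)
open import Data.Sum using (inj₁; inj₂)
open import Data.Empty using (⊥-elim)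
open import Function using (_∘_)
open import Relation.Nullary using (¬_)
open import Relation.Binary.PropositionalEquality

private variable
  d L : ℕ
  D a x k K m l A B M r t e C G : ℤ

NonSquare : ℕ → Set
NonSquare d = ∀ n → ¬ (n ℕ.* n ≡ d)

coprime-ratio-square⇒denominator≡1 : ∀ {d x y} → ℕ.Coprime x y → x ℕ.* x ≡ d ℕ.* (y ℕ.* y) → y ≡ 1
coprime-ratio-square⇒denominator≡1 {d} {x} {y} x⊥y xx≡dyy =
  x⊥y (ℕ.coprime-divisor (ℕ.sym x⊥y) y∣x*x , ℕ.∣-refl)
  where
  y∣x*x : y ℕ.∣ x ℕ.* x
  y∣x*x = ℕ.divides (d ℕ.* y) (trans xx≡dyy (sym (ℕ.*-assoc d y y)))

cancel-common-factor : ∀ {d} x y g .{{_ : NonZero g}} →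
  (x ℕ.* g) ℕ.* (x ℕ.* g) ≡ d ℕ.* ((y ℕ.* g) ℕ.* (y ℕ.* g)) → x ℕ.* x ≡ d ℕ.* (y ℕ.* y)
cancel-common-factor {d} x y g eq = ℕ.*-cancelʳ-≡ _ _ (g ℕ.* g) {{ℕ.m*n≢0 g g}} (begin
  x ℕ.* x ℕ.* (g ℕ.* g)           ≡⟨ ℕ.solve (x ∷ g ∷ []) ⟩
  (x ℕ.* g) ℕ.* (x ℕ.* g)         ≡⟨ eq ⟩
  d ℕ.* ((y ℕ.* g) ℕ.* (y ℕ.* g)) ≡⟨ ℕ.solve (d ∷ y ∷ g ∷ []) ⟩
  d ℕ.* (y ℕ.* y) ℕ.* (g ℕ.* g)   ∎)
  where open ≡-Reasoning

square-ratio⇒square : ∀ {d} m l .{{_ : NonZero l}} → m ℕ.* m ≡ d ℕ.* (l ℕ.* l) → ∃[ n ] n ℕ.* n ≡ d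
square-ratio⇒square {d} m l mm≡dll = p , trans pp≡dqq (trans (cong (d ℕ.*_) q*q≡1) (ℕ.*-identityʳ d))
  where
  g : ℕ
  g = ℕ.gcd m l
  instance
    g≢0 : NonZero g
    g≢0 = ℕ.≢-nonZero (ℕ.gcd[m,n]≢0 m l (inj₂ (ℕ.≢-nonZero⁻¹ l)))
  p q : ℕ
  p = m / g
  q = l / g
  pp≡dqq : p ℕ.* p ≡ d ℕ.* (q ℕ.* q)
  pp≡dqq = cancel-common-factor {d} p q g (subst₂ (λ i j → i ℕ.* i ≡ d ℕ.* (j ℕ.* j))
    (sym (m/n*n≡m (ℕ.gcd[m,n]∣m m l))) (sym (m/n*n≡m (ℕ.gcd[m,n]∣n m l))) mm≡dll)
  q*q≡1 : q ℕ.* q ≡ 1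
  q*q≡1 = cong (λ i → i ℕ.* i) (coprime-ratio-square⇒denominator≡1 {d} (ℕ.coprime-/gcd m l) pp≡dqq)

nonSquare⇒m*m≢d*l*l : NonSquare d → l ≢ 0ℤ → m * m ≢ + d * l * l
nonSquare⇒m*m≢d*l*l {d} {l} {m} nsq l≢0 mm≡dll =
  uncurry nsq (square-ratio⇒square {d} ∣ m ∣ ∣ l ∣ {{ℕ.≢-nonZero (l≢0 ∘ ℤ.∣i∣≡0⇒i≡0)}} |m|²≡d|l|²)
  where
  |m|²≡d|l|² : ∣ m ∣ ℕ.* ∣ m ∣ ≡ d ℕ.* (∣ l ∣ ℕ.* ∣ l ∣)
  |m|²≡d|l|² = begin
    ∣ m ∣ ℕ.* ∣ m ∣          ≡⟨ ℤ.abs-* m m ⟨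
    ∣ m * m ∣                ≡⟨ cong ∣_∣ mm≡dll ⟩
    ∣ + d * l * l ∣          ≡⟨ ℤ.abs-* (+ d * l) l ⟩
    ∣ + d * l ∣ ℕ.* ∣ l ∣    ≡⟨ cong (ℕ._* ∣ l ∣) (ℤ.abs-* (+ d) l) ⟩
    d ℕ.* ∣ l ∣ ℕ.* ∣ l ∣    ≡⟨ ℕ.*-assoc d ∣ l ∣ ∣ l ∣ ⟩
    d ℕ.* (∣ l ∣ ℕ.* ∣ l ∣)  ∎
    where open ≡-Reasoning

-- X ≡ Y follows from hypotheses Pᵢ ≡ Qᵢ once the ring solver has checked X - Y ≡ Σ cᵢ * (Pᵢ - Qᵢ).
vanishes : ∀ {P Q} c → P ≡ Q → c * (P - Q) ≡ 0ℤ
vanishes {P} c refl = trans (cong (c *_) (ℤ.+-inverseʳ P)) (ℤ.*-zeroʳ c)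

infixl 6 _⊕_
_⊕_ : ∀ {X Y} → X ≡ 0ℤ → Y ≡ 0ℤ → X + Y ≡ 0ℤ
_⊕_ = cong₂ _+_

linear-combination : ∀ {X Y Z} → Z ≡ 0ℤ → X - Y ≡ Z → X ≡ Y
linear-combination {X} {Y} Z≡0 X-Y≡Z = ℤ.i-j≡0⇒i≡j X Y (trans X-Y≡Z Z≡0)

coprime-divisor : Coprime k a → k ∣ a * x → k ∣ x
coprime-divisor {k} {a} {x} k⊥a k∣ax = ∣ᵤ⇒∣ (Coprime.coprime-divisor k a x k⊥a (∣⇒∣ᵤ k∣ax))

divisor-coprime : ∀ {c} → c ℕ.∣ ∣ l ∣ → Coprime l r → Coprime (+ c) r
divisor-coprime c∣l l⊥r (i∣c , i∣r) = l⊥r (ℕ.∣-trans i∣c c∣l , i∣r)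

coprime-combinations : ∀ p q p′ q′ → l ≡ p * A + q * B → r ≡ p′ * A + q′ * B → Coprime l r → Coprime A B
coprime-combinations {l} {A} {B} {r} p q p′ q′ l≡ r≡ l⊥r {c} (c∣A , c∣B) = l⊥r (c∣ p q l≡ , c∣ p′ q′ r≡)
  where
  c∣ : ∀ {z} p q → z ≡ p * A + q * B → c ℕ.∣ ∣ z ∣
  c∣ {z} p q z≡ = ∣⇒∣ᵤ {+ c} {z} (subst (+ c ∣_) (sym z≡)
    (∣m∣n⇒∣m+n (∣n⇒∣m*n p (∣ᵤ⇒∣ {+ c} {A} c∣A)) (∣n⇒∣m*n q (∣ᵤ⇒∣ {+ c} {B} c∣B))))

coprime⇒coprime-norm : Coprime A B → Coprime B (A * A - D * B * B)
coprime⇒coprime-norm {A} {B} {D} A⊥B {c} (c∣B , c∣N) = A⊥B (c∣A , c∣B)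
  where
  c⊥A : ℕ.Coprime c ∣ A ∣
  c⊥A (i∣c , i∣A) = A⊥B (i∣A , ℕ.∣-trans i∣c c∣B)
  c∣AA : + c ∣ A * A
  c∣AA = ∣m+n∣n⇒∣m (∣ᵤ⇒∣ {+ c} {A * A - D * B * B} c∣N)
                   (∣m⇒∣-m (∣n⇒∣m*n (D * B) (∣ᵤ⇒∣ {+ c} {B} c∣B)))
  c∣A : c ℕ.∣ ∣ A ∣
  c∣A = ℕ.coprime-divisor c⊥A (subst (c ℕ.∣_) (ℤ.abs-* A A) (∣⇒∣ᵤ {+ c} {A * A} c∣AA))

k∣x*[x*[M*M-D]] : k ≡ a * a - D * x * x → M * x - - a ≡ t * k → k ∣ x * (x * (M * M - D))
k∣x*[x*[M*M-D]] {k} {a} {D} {x} {M} {t} norm Mx+a≡tk = divides (t * t * k - + 2 * t * a + 1ℤ)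
  (linear-combination (vanishes (M * x + t * k - a) Mx+a≡tk ⊕ vanishes (- 1ℤ) norm)
    (solve (k ∷ a ∷ D ∷ x ∷ M ∷ t ∷ [])))

M*x≡-a⇒M*M≡D : Coprime x k → k ≡ a * a - D * x * x → M * x ≡ₘ - a [mod k ] → M * M ≡ₘ D [mod k ]
M*x≡-a⇒M*M≡D {x} {k} {a} {D} {M} x⊥k norm Mx≡-a with ∣ᵤ⇒∣ {k} {M * x - - a} Mx≡-a
... | divides t Mx+a≡tk = ∣⇒∣ᵤ {k} {M * M - D}
  (coprime-divisor {k = k} {a = x} k⊥x (coprime-divisor {k = k} {a = x} k⊥x
    (k∣x*[x*[M*M-D]] {k} {a} {D} {x} {M} {t} norm Mx+a≡tk)))
  where
  k⊥x : Coprime k x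
  k⊥x = Coprime.sym {x} {k} x⊥k

sign-decomposition : ∀ k → ∃[ σ ] σ * σ ≡ 1ℤ × k ≡ σ * abs k
sign-decomposition (+ n)    = 1ℤ , refl , sym (ℤ.*-identityˡ (+ n))
sign-decomposition -[1+ n ] = - 1ℤ , refl , sym (ℤ.-1*i≡-i (+ suc n))

0≤i*i : ∀ i → 0ℤ ≤ i * i
0≤i*i (+ zero) = +≤+ z≤n
0≤i*i +[1+ n ] = +≤+ z≤n
0≤i*i -[1+ n ] = +≤+ z≤n

i*i≤0⇒i≡0 : ∀ i → i * i ≤ 0ℤ → i ≡ 0ℤ
i*i≤0⇒i≡0 (+ zero) _ = refl
i*i≤0⇒i≡0 +[1+ n ] (+≤+ ())
i*i≤0⇒i≡0 -[1+ n ] (+≤+ ())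

0≤d*i*i : ∀ d i → 0ℤ ≤ + d * i * i
0≤d*i*i d i =
  subst₂ _≤_ (ℤ.*-zeroʳ (+ d)) (sym (ℤ.*-assoc (+ d) i i)) (ℤ.*-monoˡ-≤-nonNeg (+ d) (0≤i*i i))

0<m*m+d*l*l : ∀ d l → 0ℤ < m → 0ℤ < m * m + + d * l * l
0<m*m+d*l*l d l (+<+ (s≤s z≤n)) = ℤ.+-mono-<-≤ (+<+ (s≤s z≤n)) (0≤d*i*i d l)

scaled-norm-difference : m * m + D * l * l - (m * G) * (m * G) - D * (l * G) * (l * G)
                       ≡ - ((G * G - 1ℤ) * (m * m + D * l * l))
scaled-norm-difference {m} {D} {l} {G} = solve (m ∷ D ∷ l ∷ G ∷ [])

scaled-discriminant :
  let U = m * m + D * l * l - (m * G) * (m * G) - D * (l * G) * (l * G)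
      V = + 2 * ((m * G) * (l * G) - m * l)
  in U * U - D * V * V ≡ ((G * G - 1ℤ) * (m * m - D * l * l)) * ((G * G - 1ℤ) * (m * m - D * l * l))
scaled-discriminant {m} {D} {l} {G} = solve (m ∷ D ∷ l ∷ G ∷ [])

-- |G m - √d G l| = |G| |m - √d l| > |m - √d l|, since m - √d l ≠ 0.
scaled-pair-not-closer : NonSquare d → 0ℤ < m → l ≢ 0ℤ → 0ℤ < G * G - 1ℤ →
  ¬ AbsDistLe d (m * G) (l * G) m l
scaled-pair-not-closer {d} {m} {l} {G} nsq m>0 l≢0 h>0 = λ
  { (inj₁ (U≥0 , _))               → ℤ.<⇒≱ U<0 U≥0
  ; (inj₂ (inj₁ (U≥0 , _)))        → ℤ.<⇒≱ U<0 U≥0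
  ; (inj₂ (inj₂ (_ , _ , U²≤DV²))) → nonSquare⇒m*m≢d*l*l {d} {l} {m} nsq l≢0 (m*m≡dll U²≤DV²)
  }
  where
  h U V : ℤ
  h = G * G - 1ℤ
  U = m * m + + d * l * l - (m * G) * (m * G) - + d * (l * G) * (l * G)
  V = + 2 * ((m * G) * (l * G) - m * l)
  U<0 : U < 0ℤ
  U<0 = subst (_< 0ℤ) (sym (scaled-norm-difference {m} {+ d} {l} {G})) (ℤ.neg-mono-<
    (subst (_< h * _) (ℤ.*-zeroʳ h) (ℤ.*-monoˡ-<-pos h {{ℤ.positive h>0}} (0<m*m+d*l*l d l m>0))))
  m*m≡dll : U * U ≤ + d * V * V → m * m ≡ + d * l * l
  m*m≡dll U²≤DV² = ℤ.i-j≡0⇒i≡j _ _ (ℤ.*-cancelˡ-≡ h _ 0ℤ {{ℤ.≢-nonZero (≢-sym (ℤ.<⇒≢ h>0))}}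
    (trans (i*i≤0⇒i≡0 _ (subst (_≤ 0ℤ) (scaled-discriminant {m} {+ d} {l} {G}) (ℤ.i≤j⇒i-j≤0 U²≤DV²)))
           (sym (ℤ.*-zeroʳ h))))

ClosestPair : ℕ → ℕ → ℤ → ℤ → ℤ → ℤ → ℤ → Set
ClosestPair d L k a x m l = ∀ m′ l′ → 0ℤ < m′ → 1ℤ ≤ l′ → l′ ≤ + L →
  k Unsigned.∣ (a * l′ + x * m′) → AbsDistLe d m l m′ l′

closest-pair⇒no-common-factor : NonSquare d → 0ℤ < C → 0ℤ < C * C - 1ℤ → 0ℤ < m → 1ℤ ≤ l → l ≤ + L →
  ClosestPair d L k a x m l → k ∣ K → M * x - - a ≡ t * K → r * K ≡ m - M * l → C ∣ l → ¬ C ∣ r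
closest-pair⇒no-common-factor {d} {C} {m} {l} {L} {k} {a} {x} {K} {M} {t} {r}
  nsq C>0 h>0 m>0 l≥1 l≤L closest k∣K Mx+a≡tK rK≡m-Ml (divides l′ l≡l′C) (divides r′ r≡r′C) =
  scaled-pair-not-closer nsq m′>0 (≢-sym (ℤ.<⇒≢ l′>0)) h>0
    (subst₂ (λ u v → AbsDistLe d u v m′ l′) m≡m′C l≡l′C
      (closest m′ l′ m′>0 (ℤ.i<j⇒suc[i]≤j l′>0) (ℤ.≤-trans l′≤l l≤L) k∣al′+xm′))
  where
  m′ : ℤ
  m′ = M * l′ + r′ * K
  m≡m′C : m ≡ (M * l′ + r′ * K) * C
  m≡m′C = linear-combination (vanishes (- 1ℤ) rK≡m-Ml ⊕ vanishes M l≡l′C ⊕ vanishes K r≡r′C)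
    (solve (C ∷ m ∷ l ∷ K ∷ M ∷ r ∷ l′ ∷ r′ ∷ []))
  instance
    C≥0 : ℤ.NonNegative C
    C≥0 = ℤ.nonNegative (ℤ.<⇒≤ C>0)
  m′>0 : 0ℤ < m′
  m′>0 = ℤ.*-cancelʳ-<-nonNeg C (subst (0ℤ <_) m≡m′C m>0)
  l′>0 : 0ℤ < l′
  l′>0 = ℤ.*-cancelʳ-<-nonNeg C (subst (0ℤ <_) l≡l′C (ℤ.suc[i]≤j⇒i<j {0ℤ} l≥1))
  l′≤l : l′ ≤ l
  l′≤l = subst₂ _≤_ (ℤ.*-identityʳ l′) (sym l≡l′C)
    (ℤ.*-monoˡ-≤-nonNeg l′ {{ℤ.nonNegative (ℤ.<⇒≤ l′>0)}} (ℤ.i<j⇒suc[i]≤j C>0))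
  al′+xm′≡[tl′+xr′]K : a * l′ + x * (M * l′ + r′ * K) ≡ (t * l′ + x * r′) * K
  al′+xm′≡[tl′+xr′]K = linear-combination (vanishes l′ Mx+a≡tK) (solve (a ∷ x ∷ K ∷ M ∷ t ∷ l′ ∷ r′ ∷ []))
  k∣al′+xm′ : k Unsigned.∣ (a * l′ + x * m′)
  k∣al′+xm′ = ∣⇒∣ᵤ {k} {a * l′ + x * m′} (∣-trans k∣K (divides (t * l′ + x * r′) al′+xm′≡[tl′+xr′]K))

closest-pair⇒coprime : NonSquare d → 0ℤ < m → 1ℤ ≤ l → l ≤ + L → ClosestPair d L k a x m l →
  k ∣ K → M * x - - a ≡ t * K → r * K ≡ m - M * l → Coprime l r
closest-pair⇒coprime _ _ l≥1 _ _ _ _ _ {zero} (0∣l , _) =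
  ⊥-elim (ℤ.<⇒≢ (ℤ.suc[i]≤j⇒i<j {0ℤ} l≥1) (sym (ℤ.∣i∣≡0⇒i≡0 (ℕ.0∣⇒≡0 0∣l))))
closest-pair⇒coprime _ _ _ _ _ _ _ _ {suc zero} _ = refl
closest-pair⇒coprime {d} {m} {l} {L} {k} {a} {x} {K} {M} {t} {r}
  nsq m>0 l≥1 l≤L closest k∣K Mx+a≡tK rK≡m-Ml {suc (suc n)} (c∣l , c∣r) =
  ⊥-elim (closest-pair⇒no-common-factor {d} {+ suc (suc n)} {m} {l} {L} {k} {a} {x} {K} {M} {t} {r}
    nsq (+<+ (s≤s z≤n)) (+<+ (s≤s z≤n)) m>0 l≥1 l≤L closest k∣K Mx+a≡tK rK≡m-Ml
    (∣ᵤ⇒∣ {+ suc (suc n)} {l} c∣l) (∣ᵤ⇒∣ {+ suc (suc n)} {r} c∣r))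

module StepIdentities (D a x k K σ M t e m l r k′ A B : ℤ) .{{_ : ℤ.NonZero K}}
  (σ²≡1 : σ * σ ≡ 1ℤ) (k≡σK : k ≡ σ * K) (norm : k ≡ a * a - D * x * x)
  (Mx+a≡tK : M * x - - a ≡ t * K) (M²-D≡eK : M * M - D ≡ e * K) (rK≡m-Ml : r * K ≡ m - M * l)
  (k′k≡m²-Dl² : k′ * k ≡ m * m - D * l * l)
  (AK≡am+Dxl : A * K ≡ a * m + D * x * l) (BK≡al+xm : B * K ≡ a * l + x * m)
  where

  s : ℤ
  s = - (e * l) - M * r

  sK≡Dl-Mm : (- (e * l) - M * r) * K ≡ D * l - M * m
  sK≡Dl-Mm = linear-combination (vanishes (- M) rK≡m-Ml ⊕ vanishes l M²-D≡eK)
    (solve (D ∷ K ∷ M ∷ e ∷ m ∷ l ∷ r ∷ []))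

  A≡xs+tm : A ≡ x * (- (e * l) - M * r) + t * m
  A≡xs+tm = ℤ.*-cancelʳ-≡ _ _ K (linear-combination
    (vanishes 1ℤ AK≡am+Dxl ⊕ vanishes m Mx+a≡tK ⊕ vanishes (- x) sK≡Dl-Mm)
    (solve (D ∷ a ∷ x ∷ K ∷ M ∷ t ∷ e ∷ m ∷ l ∷ r ∷ A ∷ [])))

  B≡tl+xr : B ≡ t * l + x * r
  B≡tl+xr = ℤ.*-cancelʳ-≡ _ _ K (linear-combination
    (vanishes 1ℤ BK≡al+xm ⊕ vanishes l Mx+a≡tK ⊕ vanishes (- x) rK≡m-Ml)
    (solve (a ∷ x ∷ K ∷ M ∷ t ∷ m ∷ l ∷ r ∷ B ∷ [])))

  σ≡Kt²-2Mxt+ex² : σ ≡ K * t * t - + 2 * M * x * t + e * x * x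
  σ≡Kt²-2Mxt+ex² = ℤ.*-cancelʳ-≡ _ _ K (linear-combination
    (vanishes (- 1ℤ) k≡σK ⊕ vanishes 1ℤ norm ⊕ vanishes (a + t * K - M * x) Mx+a≡tK
      ⊕ vanishes (x * x) M²-D≡eK)
    (solve (D ∷ a ∷ x ∷ k ∷ K ∷ σ ∷ M ∷ t ∷ e ∷ [])))

  k′σ≡el²+2Mlr+Kr² : k′ * σ ≡ e * l * l + + 2 * M * l * r + K * r * r
  k′σ≡el²+2Mlr+Kr² = ℤ.*-cancelʳ-≡ _ _ K (linear-combination
    (vanishes (- k′) k≡σK ⊕ vanishes 1ℤ k′k≡m²-Dl² ⊕ vanishes (- (m + r * K + M * l)) rK≡m-Ml
      ⊕ vanishes (l * l) M²-D≡eK)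
    (solve (D ∷ k ∷ K ∷ σ ∷ M ∷ e ∷ m ∷ l ∷ r ∷ k′ ∷ [])))

  k′≡A²-DB² : k′ ≡ A * A - D * B * B
  k′≡A²-DB² = ℤ.*-cancelʳ-≡ _ _ (K * K) {{ℤ.i*j≢0 K K}} (linear-combination
    (vanishes (- (k′ * K * K)) σ²≡1 ⊕ vanishes (- (k′ * (k + σ * K))) k≡σK ⊕ vanishes (m * m - D * l * l) norm
      ⊕ vanishes k k′k≡m²-Dl² ⊕ vanishes (- (A * K + (a * m + D * x * l))) AK≡am+Dxl
      ⊕ vanishes (D * (B * K + (a * l + x * m))) BK≡al+xm)
    (solve (D ∷ a ∷ x ∷ k ∷ K ∷ σ ∷ m ∷ l ∷ k′ ∷ A ∷ B ∷ [])))

  Ar-Bs≡tσk′ : A * r - B * (- (e * l) - M * r) ≡ t * σ * k′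
  Ar-Bs≡tσk′ = linear-combination
    (vanishes r A≡xs+tm ⊕ vanishes (- (- (e * l) - M * r)) B≡tl+xr ⊕ vanishes (- t) k′σ≡el²+2Mlr+Kr²
      ⊕ vanishes (- (t * r)) rK≡m-Ml)
    (solve (x ∷ K ∷ σ ∷ M ∷ t ∷ e ∷ m ∷ l ∷ r ∷ k′ ∷ A ∷ B ∷ []))

  l≡-σxA+σaB : l ≡ - (σ * x) * A + σ * a * B
  l≡-σxA+σaB = ℤ.*-cancelʳ-≡ _ _ K (linear-combination
    (vanishes (- (l * K)) σ²≡1 ⊕ vanishes (- (σ * l)) k≡σK ⊕ vanishes (σ * l) norm
      ⊕ vanishes (- (σ * a)) BK≡al+xm ⊕ vanishes (σ * x) AK≡am+Dxl)
    (solve (D ∷ a ∷ x ∷ k ∷ K ∷ σ ∷ m ∷ l ∷ A ∷ B ∷ [])))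

  r≡σtA+σ[ex-Mt]B : r ≡ σ * t * A + σ * (e * x - M * t) * B
  r≡σtA+σ[ex-Mt]B = linear-combination
    (vanishes (- r) σ²≡1 ⊕ vanishes (- (σ * t)) A≡xs+tm ⊕ vanishes (- (σ * (e * x - M * t))) B≡tl+xr
      ⊕ vanishes (σ * r) σ≡Kt²-2Mxt+ex² ⊕ vanishes (σ * t * t) rK≡m-Ml)
    (solve (x ∷ K ∷ σ ∷ M ∷ t ∷ e ∷ m ∷ l ∷ r ∷ A ∷ B ∷ []))

  A+MB≡l[2Mt-ex]+Krt : A + M * B ≡ l * (+ 2 * M * t - e * x) + K * r * t
  A+MB≡l[2Mt-ex]+Krt = linear-combination
    (vanishes 1ℤ A≡xs+tm ⊕ vanishes M B≡tl+xr ⊕ vanishes (- t) rK≡m-Ml)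
    (solve (x ∷ K ∷ M ∷ t ∷ e ∷ m ∷ l ∷ r ∷ A ∷ B ∷ []))

  rKr≡k′σ-l[el+2Mr] : r * (K * r) ≡ k′ * σ - l * (e * l + + 2 * M * r)
  rKr≡k′σ-l[el+2Mr] = linear-combination (vanishes (- 1ℤ) k′σ≡el²+2Mlr+Kr²)
    (solve (K ∷ σ ∷ M ∷ e ∷ l ∷ r ∷ k′ ∷ []))

  Ar≡Bs[mod-k′] : A * r ≡ₘ B * s [mod k′ ]
  Ar≡Bs[mod-k′] = ∣⇒∣ᵤ {k′} {A * r - B * s} (divides (t * σ) Ar-Bs≡tσk′)

  coprime-A-B : Coprime l r → Coprime A B
  coprime-A-B = coprime-combinations {l = l} {A = A} {B = B} {r = r}
    (- (σ * x)) (σ * a) (σ * t) (σ * (e * x - M * t)) l≡-σxA+σaB r≡σtA+σ[ex-Mt]B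

  M′≡M[mod-gcd-l-k′] : ∀ M′ → Coprime l r → Coprime B k′ → M′ * B ≡ₘ - A [mod k′ ] →
    M′ ≡ₘ M [mod gcd l k′ ]
  M′≡M[mod-gcd-l-k′] M′ l⊥r B⊥k′ M′B≡-A = ∣⇒∣ᵤ {g} {M′ - M} (coprime-divisor {k = g} {a = B} g⊥B g∣B[M′-M])
    where
    g : ℤ
    g = gcd l k′
    g∣l : g ∣ l
    g∣l = ∣ᵤ⇒∣ {g} {l} (gcd[i,j]∣i l k′)
    g∣k′ : g ∣ k′
    g∣k′ = ∣ᵤ⇒∣ {g} {k′} (gcd[i,j]∣j l k′)
    g⊥B : Coprime g B
    g⊥B = divisor-coprime {l = k′} {r = B} (gcd[i,j]∣j l k′) (Coprime.sym {B} {k′} B⊥k′)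
    g∣Kr : g ∣ K * r
    g∣Kr = coprime-divisor {k = g} {a = r} (divisor-coprime {l = l} {r = r} (gcd[i,j]∣i l k′) l⊥r)
      (subst (g ∣_) (sym rKr≡k′σ-l[el+2Mr])
        (∣m∣n⇒∣m-n (∣m⇒∣m*n σ g∣k′) (∣m⇒∣m*n (e * l + + 2 * M * r) g∣l)))
    g∣A+MB : g ∣ A + M * B
    g∣A+MB = subst (g ∣_) (sym A+MB≡l[2Mt-ex]+Krt)
      (∣m∣n⇒∣m+n (∣m⇒∣m*n (+ 2 * M * t - e * x) g∣l) (∣m⇒∣m*n t g∣Kr))
    M′B+A-[A+MB]≡B[M′-M] : M′ * B - - A - (A + M * B) ≡ B * (M′ - M)
    M′B+A-[A+MB]≡B[M′-M] = solve (M′ ∷ M ∷ A ∷ B ∷ [])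
    g∣B[M′-M] : g ∣ B * (M′ - M)
    g∣B[M′-M] = subst (g ∣_) M′B+A-[A+MB]≡B[M′-M]
      (∣m∣n⇒∣m-n (∣-trans g∣k′ (∣ᵤ⇒∣ {k′} {M′ * B - - A} M′B≡-A)) g∣A+MB)

record CoprimeRepresentation (D a x k : ℤ) : Set where
  field
    nonzero : k ≢ 0ℤ
    norm    : k ≡ a * a - D * x * x
    coprime : Coprime x k

initial-representation : NonSquare d → x ≡ 1ℤ → k ≡ a * a - + d * x * x → CoprimeRepresentation (+ d) a x k
initial-representation {d} {a = a} nsq refl norm = record
  { nonzero = λ k≡0 → nonSquare⇒m*m≢d*l*l {d} {1ℤ} {a} nsq (λ ()) (ℤ.i-j≡0⇒i≡j _ _ (trans (sym norm) k≡0))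
  ; norm    = norm
  ; coprime = λ (c∣1 , _) → ℕ.∣1⇒≡1 c∣1
  }

StepConclusion : ℤ → ℤ → ℤ → ℤ → ℤ → ℤ → ℤ → ℤ → ℤ → ℤ → Set
StepConclusion D k m l k′ A B M r M′ = Σ ℤ λ s →
  (s * abs k ≡ D * l - M * m) × (A * r ≡ₘ B * s [mod abs k′ ]) × (gcd l r ≡ + 1) × (M′ ≡ₘ M [mod gcd l k′ ])

algorithm-step : NonSquare d → ∀ a x k m l k′ A B M r M′ →
  CoprimeRepresentation (+ d) a x k → M * x ≡ₘ - a [mod abs k ] →
  0ℤ < m → 1ℤ ≤ l → l ≤ + L → ClosestPair d L k a x m l →
  k′ * k ≡ m * m - + d * l * l → A * abs k ≡ a * m + + d * x * l → B * abs k ≡ a * l + x * m →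
  r * abs k ≡ m - M * l → M′ * B ≡ₘ - A [mod abs k′ ] →
  StepConclusion (+ d) k m l k′ A B M r M′ × CoprimeRepresentation (+ d) A B k′
algorithm-step {d} {L} nsq a x k m l k′ A B M r M′
  rep Mx≡-a m>0 l≥1 l≤L closest k′k≡m²-Dl² AK≡am+Dxl BK≡al+xm rK≡m-Ml M′B≡-A =
  (s , sK≡Dl-Mm , Ar≡Bs[mod-k′] , cong +_ (ℕ.coprime⇒gcd≡1 l⊥r) , M′≡M[mod-gcd-l-k′] M′ l⊥r B⊥k′ M′B≡-A)
  , record { nonzero = k′≢0 ; norm = k′≡A²-DB² ; coprime = B⊥k′ }
  where
  open CoprimeRepresentation rep
  instance
    K≢0 : ℤ.NonZero (abs k)
    K≢0 = ℤ.≢-nonZero (nonzero ∘ ℤ.∣i∣≡0⇒i≡0 ∘ ℤ.+-injective)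
  K∣Mx+a : abs k ∣ M * x - - a
  K∣Mx+a = ∣ᵤ⇒∣ {abs k} {M * x - - a} Mx≡-a
  K∣M²-D : abs k ∣ M * M - + d
  K∣M²-D = ∣ᵤ⇒∣ {abs k} {M * M - + d} (M*x≡-a⇒M*M≡D {x} {k} {a} {+ d} {M} coprime norm Mx≡-a)
  sign-k : ∃[ σ ] σ * σ ≡ 1ℤ × k ≡ σ * abs k
  sign-k = sign-decomposition k
  open StepIdentities (+ d) a x k (abs k) (proj₁ sign-k) M (quotient K∣Mx+a) (quotient K∣M²-D) m l r k′ A B
    (proj₁ (proj₂ sign-k)) (proj₂ (proj₂ sign-k)) norm (_∣_.equality K∣Mx+a) (_∣_.equality K∣M²-D)
    rK≡m-Ml k′k≡m²-Dl² AK≡am+Dxl BK≡al+xm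
  l⊥r : Coprime l r
  l⊥r = closest-pair⇒coprime {d} {m} {l} {L} {k} {a} {x} {abs k} {M} {quotient K∣Mx+a} {r}
    nsq m>0 l≥1 l≤L closest m∣∣m∣ (_∣_.equality K∣Mx+a) rK≡m-Ml
  B⊥k′ : Coprime B k′
  B⊥k′ = subst (Coprime B) (sym k′≡A²-DB²) (coprime⇒coprime-norm {A} {B} {+ d} (coprime-A-B l⊥r))
  k′≢0 : k′ ≢ 0ℤ
  k′≢0 k′≡0 = nonSquare⇒m*m≢d*l*l {d} {l} {m} nsq (≢-sym (ℤ.<⇒≢ (ℤ.suc[i]≤j⇒i<j {0ℤ} l≥1)))
    (ℤ.i-j≡0⇒i≡j _ _ (trans (sym k′k≡m²-Dl²) (cong (_* k) k′≡0)))

proposition9 : (d L : ℕ) → 0 ℕ.< d → (∀ n → ¬ (n ℕ.* n ≡ d)) → 0 ℕ.< L →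
  (s : ℕ) → s ℕ.* s ℕ.≤ d → d ℕ.< suc s ℕ.* suc s →
  (a b k m l M r : ℕ → ℤ) →
  a 1 ≡ firstA d s → b 1 ≡ + 1 → k 2 ≡ a 1 * a 1 - (+ d) * b 1 * b 1 →
  (∀ i → 2 ℕ.≤ i → SecondAlgStep d L a b k m l i) →
  (∀ i → 2 ℕ.≤ i →
    (+ 0 ≤ M i) × (M i < abs (k i)) × (M i * b (i ∸ 1) ≡ₘ - a (i ∸ 1) [mod abs (k i) ])) →
  (∀ i → 3 ℕ.≤ i → r (i ∸ 1) * abs (k (i ∸ 1)) ≡ m i - M (i ∸ 1) * l i) →
  ∀ i → 3 ℕ.≤ i →
    Σ ℤ (λ s' →
      (s' * abs (k (i ∸ 1)) ≡ (+ d) * l i - M (i ∸ 1) * m i)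
      × (a (i ∸ 1) * r (i ∸ 1) ≡ₘ b (i ∸ 1) * s' [mod abs (k i) ])
      × (gcd (l i) (r (i ∸ 1)) ≡ + 1)
      × (M i ≡ₘ M (i ∸ 1) [mod gcd (l i) (k i) ]))
proposition9 _ _ _ _ _ _ _ _ _ _ _ _ _ _ _ _ _ _ _ _ _ zero ()
proposition9 _ _ _ _ _ _ _ _ _ _ _ _ _ _ _ _ _ _ _ _ _ (suc zero) (s≤s ())
proposition9 _ _ _ _ _ _ _ _ _ _ _ _ _ _ _ _ _ _ _ _ _ (suc (suc zero)) (s≤s (s≤s ()))
proposition9 d L _ nsq _ _ _ _ a b k m l M r _ b₁≡1 k₂≡ algorithm residue r-def (suc (suc (suc n))) _ =
  proj₁ (advance n)
  where
  -- Only b₁ = 1 is used; the value of a₁ plays no role.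
  representation : ∀ n → CoprimeRepresentation (+ d) (a (suc n)) (b (suc n)) (k (suc (suc n)))
  advance : ∀ n →
    let i = suc (suc n) in
    StepConclusion (+ d) (k i) (m (suc i)) (l (suc i)) (k (suc i)) (a i) (b i) (M i) (r i) (M (suc i))
    × CoprimeRepresentation (+ d) (a i) (b i) (k (suc i))
  representation zero    = initial-representation nsq b₁≡1 k₂≡
  representation (suc n) = proj₂ (advance n)
  advance n = algorithm-step nsq
    (a (suc n)) (b (suc n)) (k i) (m (suc i)) (l (suc i)) (k (suc i)) (a i) (b i) (M i) (r i) (M (suc i))
    (representation n) (proj₂ (proj₂ (residue i (s≤s (s≤s z≤n))))) m-pos l-pos l-le minimal k-def a-def b-def
    (r-def (suc i) (s≤s (s≤s (s≤s z≤n)))) (proj₂ (proj₂ (residue (suc i) (s≤s (s≤s z≤n)))))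
    where
    i : ℕ
    i = suc (suc n)
    open SecondAlgStep (algorithm i (s≤s (s≤s z≤n)))
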